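{- Let $q>2$ be a prime power, $s\geq 3$ an integer, and let $\Omega$ be a non-empty family of hyperplanes of $\mathrm{PG}(s,q^2)$ such that every point lies in exactly $\frac{q^s(q^{s-1}-(-1)^{s-1})}{q+1}$ or exactly $\frac{q^{s-1}(q^s-(-1)^s)}{q+1}$ hyperplanes of $\Omega$. Then $q^{s-1}$ divides $|\Omega|$, and setting $|\Omega_1|=|\Omega|/q^{s-1}$ there is an integer $t$ with $1\leq t\leq q^2$ such that $|\Omega_1|=\frac{q^{s+2}-1}{q+1}-(q-1)+t$ if $s$ is even, and $|\Omega_1|=\frac{q^{s+2}+1}{q+1}-(q^2-q+1)+t$ if $s$ is odd. -}

module Defs where

open import Level using (0ℓ)
open import Data.Nat using (ℕ; zero; suc; _+_; _*_; _^_; _≤_)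
open import Data.Bool using (Bool; true; false; if_then_else_)
open import Data.Fin using (Fin)
open import Data.Fin.Properties using (_≟_)
open import Data.Bool.Properties renaming (_≟_ to _≟ᵇ_) using ()
open import Data.List using (List; []; _∷_; map; concatMap; filter; length; allFin; foldr)
open import Data.Product using (Σ; _×_; ∃-syntax)
open import Data.Nat.Primality using (Prime)
open import Relation.Binary.PropositionalEquality using (_≡_)
open import Relation.Nullary using (¬_; yes; no; does)
open import Algebra.Structures using (IsCommutativeRing)

IsPrimePower : ℕ → Set
IsPrimePower q = ∃[ p ] ∃[ k ] (Prime p × 1 ≤ k × q ≡ p ^ k)

record FiniteField (Q : ℕ) : Set where
  field
    _⊕_ _⊗_ : Fin Q → Fin Q → Fin Q
    ⊖_      : Fin Q → Fin Q
    0# 1#   : Fin Q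
    isCommutativeRing : IsCommutativeRing _≡_ _⊕_ _⊗_ ⊖_ 0# 1#
    0≢1     : ¬ (0# ≡ 1#)
    inverse : ∀ x → ¬ (x ≡ 0#) → Σ (Fin Q) (λ y → x ⊗ y ≡ 1#)

module _ {Q : ℕ} (F : FiniteField Q) where
  open FiniteField F

  Vector : ℕ → Set
  Vector n = Fin n → Fin Q

  allVectors : (n : ℕ) → List (Vector n)
  allVectors zero = (λ ()) ∷ []
  allVectors (suc n) =
    concatMap (λ a → map (λ v → cons a v) (allVectors n)) (allFin Q)
    where
    cons : Fin Q → Vector n → Vector (suc n)
    cons a v Fin.zero = a
    cons a v (Fin.suc i) = v i

  -- a vector is the normalised representative of a projective point:
  -- it is nonzero and its first nonzero coordinate equals 1
  isNormalised : ∀ {n} → Vector n → Bool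
  isNormalised {zero} v = false
  isNormalised {suc n} v with does (v Fin.zero ≟ 0#)
  ... | true  = isNormalised {n} (λ i → v (Fin.suc i))
  ... | false = does (v Fin.zero ≟ 1#)

  -- the points of PG(s, F), i.e. 1-dim subspaces of F^(s+1), one
  -- normalised representative each; by duality the same list indexes
  -- the hyperplanes { x | Σ a_i x_i = 0 } of PG(s, F)
  projPoints : (s : ℕ) → List (Vector (suc s))
  projPoints s = filter (λ v → _≟ᵇ_ (isNormalised v) true) (allVectors (suc s))

  dot : ∀ {n} → Vector n → Vector n → Fin Q
  dot a x = foldr _⊕_ 0# (map (λ i → a i ⊗ x i) (allFin _))

  incident : ∀ {n} → Vector n → Vector n → Bool
  incident a x = does (dot a x ≟ 0#)

  -- a family Ω of hyperplanes of PG(s,F) is a Boolean predicate on the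
  -- normalised coordinate vectors of hyperplanes
  HyperplaneFamily : ℕ → Set
  HyperplaneFamily s = Vector (suc s) → Bool

  size : ∀ {s} → HyperplaneFamily s → ℕ
  size {s} Ω = length (filter (λ a → _≟ᵇ_ (Ω a) true) (projPoints s))

  degree : ∀ {s} → HyperplaneFamily s → Vector (suc s) → ℕ
  degree {s} Ω x =
    length (filter (λ a → _≟ᵇ_ (Ω a ∧' incident a x) true) (projPoints s))
    where
    _∧'_ : Bool → Bool → Bool
    true ∧' b = b
    false ∧' b = false

-- Count the incident pairs (x, H) with H ∈ Ω in two ways.  A hyperplane of PG(s, Q), Q = q², has
-- θₛ = 1 + Q + ⋯ + Q^(s-1) points, so |Ω|·θₛ = Σₓ deg x.  Both admissible degrees have the form
-- u·L and u·(L+1) with u = q^(s-1), hence Σₓ deg x = u·(L·θₛ₊₁ + N) where N ≤ θₛ₊₁ = 1 + Q·θₛ counts the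
-- points of the larger degree.  As θₛ ≡ 1 (mod q), u divides |Ω|, and |Ω₁| = |Ω|/u satisfies
-- |Ω₁|·θₛ = Q·L·θₛ + (L + N) with 0 < L + N < (Q + 1)·θₛ, so |Ω₁| = Q·L + t with 1 ≤ t ≤ Q.
-- Evaluating Q·L separately for even and odd s gives the closed forms.
module Submission where

module Sums where

  open import Data.Bool.Base using (Bool; true; false; _∧_)
  open import Data.Bool.Properties using () renaming (_≟_ to _≟ᵇ_)
  open import Data.Fin.Base using (Fin; zero; suc)
  open import Data.Fin.Properties using (_≟_)
  open import Data.List.Base using (List; []; _∷_; _++_; map; concatMap; filter; length; allFin)
  open import Data.List.Membership.Propositional using (_∈_)
  open import Data.List.Relation.Unary.Any using (here; there)
  open import Data.List.Properties using (map-tabulate)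
  open import Data.Nat.Base using (ℕ; zero; suc; _+_; _*_; _≤_; z≤n; s≤s)
  open import Data.Nat.ListAction using (sum)
  open import Data.Nat.Properties using (+-assoc; +-identityʳ; *-zeroʳ; *-comm; *-distribˡ-+; m≤n⇒m≤1+n)
  open import Data.Nat.Solver using (module +-*-Solver)
  open import Data.Product.Base using (_×_; _,_; ∃-syntax)
  open import Data.Sum.Base using (_⊎_; inj₁; inj₂)
  open import Function.Base using (_∘_; id)
  open import Relation.Binary.PropositionalEquality using (_≡_; refl; sym; trans; cong; cong₂; module ≡-Reasoning)
  open import Relation.Nullary.Decidable using (does)

  open +-*-Solver using (solve; _:+_; _:*_; _:=_; con)

  [_] : Bool → ℕ
  [ true ]  = 1
  [ false ] = 0

  [∧] : ∀ b c → [ b ∧ c ] ≡ [ b ] * [ c ]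
  [∧] true  c = sym (+-identityʳ [ c ])
  [∧] false c = refl

  ∑ : {A : Set} → (A → ℕ) → List A → ℕ
  ∑ f xs = sum (map f xs)

  module _ {A : Set} where

    ∑-cong-∈ : ∀ {f g : A → ℕ} xs → (∀ {x} → x ∈ xs → f x ≡ g x) → ∑ f xs ≡ ∑ g xs
    ∑-cong-∈ []       f≡g = refl
    ∑-cong-∈ (x ∷ xs) f≡g = cong₂ _+_ (f≡g (here refl)) (∑-cong-∈ xs (f≡g ∘ there))

    ∑-cong : ∀ {f g : A → ℕ} → (∀ x → f x ≡ g x) → ∀ xs → ∑ f xs ≡ ∑ g xs
    ∑-cong f≡g xs = ∑-cong-∈ xs (λ {x} _ → f≡g x)

    ∑-+ : ∀ (f g : A → ℕ) xs → ∑ (λ x → f x + g x) xs ≡ ∑ f xs + ∑ g xs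
    ∑-+ f g []       = refl
    ∑-+ f g (x ∷ xs) = trans (cong (f x + g x +_) (∑-+ f g xs))
      (solve 4 (λ a b c d → (a :+ b) :+ (c :+ d) := (a :+ c) :+ (b :+ d)) refl (f x) (g x) (∑ f xs) (∑ g xs))

    ∑-*ˡ : ∀ c (f : A → ℕ) xs → ∑ (λ x → c * f x) xs ≡ c * ∑ f xs
    ∑-*ˡ c f []       = sym (*-zeroʳ c)
    ∑-*ˡ c f (x ∷ xs) = trans (cong (c * f x +_) (∑-*ˡ c f xs)) (sym (*-distribˡ-+ c (f x) (∑ f xs)))

    ∑-*ʳ : ∀ c (f : A → ℕ) xs → ∑ (λ x → f x * c) xs ≡ ∑ f xs * c
    ∑-*ʳ c f xs = trans (∑-cong (λ x → *-comm (f x) c) xs) (trans (∑-*ˡ c f xs) (*-comm c (∑ f xs)))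

    ∑-++ : ∀ (f : A → ℕ) xs ys → ∑ f (xs ++ ys) ≡ ∑ f xs + ∑ f ys
    ∑-++ f []       ys = refl
    ∑-++ f (x ∷ xs) ys = trans (cong (f x +_) (∑-++ f xs ys)) (sym (+-assoc (f x) (∑ f xs) (∑ f ys)))

    ∑-filter : ∀ (P : A → Bool) (f : A → ℕ) xs →
      ∑ f (filter (λ x → P x ≟ᵇ true) xs) ≡ ∑ (λ x → [ P x ] * f x) xs
    ∑-filter P f []       = refl
    ∑-filter P f (x ∷ xs) with P x
    ... | true  = cong₂ _+_ (sym (+-identityʳ (f x))) (∑-filter P f xs)
    ... | false = ∑-filter P f xs

    length-filter : ∀ {P : A → Bool} xs → length (filter (λ x → P x ≟ᵇ true) xs) ≡ ∑ (λ x → [ P x ]) xs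
    length-filter {P} []       = refl
    length-filter {P} (x ∷ xs) with P x
    ... | true  = cong suc (length-filter xs)
    ... | false = length-filter xs

  module _ {A B : Set} where

    ∑-map : ∀ (f : B → ℕ) (g : A → B) xs → ∑ f (map g xs) ≡ ∑ (f ∘ g) xs
    ∑-map f g []       = refl
    ∑-map f g (x ∷ xs) = cong (f (g x) +_) (∑-map f g xs)

    ∑-concatMap : ∀ (f : B → ℕ) (g : A → List B) xs → ∑ f (concatMap g xs) ≡ ∑ (λ x → ∑ f (g x)) xs
    ∑-concatMap f g []       = refl
    ∑-concatMap f g (x ∷ xs) = trans (∑-++ f (g x) (concatMap g xs)) (cong (∑ f (g x) +_) (∑-concatMap f g xs))

    ∑-comm : ∀ (f : A → B → ℕ) xs ys → ∑ (λ x → ∑ (f x) ys) xs ≡ ∑ (λ y → ∑ (λ x → f x y) xs) ys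
    ∑-comm f []       ys = sym (∑-*ˡ 0 (λ _ → 0) ys)
    ∑-comm f (x ∷ xs) ys = trans (cong (∑ (f x) ys +_) (∑-comm f xs ys)) (sym (∑-+ (f x) _ ys))

  ∑-allFin-suc : ∀ {n} (f : Fin (suc n) → ℕ) → ∑ f (allFin (suc n)) ≡ f zero + ∑ (f ∘ suc) (allFin n)
  ∑-allFin-suc {n} f = cong (f zero +_) (trans (cong (∑ f) (sym (map-tabulate id suc))) (∑-map f suc (allFin n)))

  ∑-allFin-const : ∀ n c → ∑ (λ _ → c) (allFin n) ≡ n * c
  ∑-allFin-const zero    c = refl
  ∑-allFin-const (suc n) c = trans (∑-allFin-suc {n} (λ _ → c)) (cong (c +_) (∑-allFin-const n c))

  ∑-allFin-δ : ∀ {n} (y : Fin n) (f : Fin n → ℕ) → ∑ (λ i → [ does (i ≟ y) ] * f i) (allFin n) ≡ f y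
  ∑-allFin-δ {suc n} zero    f = begin
    ∑ (λ i → [ does (i ≟ zero) ] * f i) (allFin (suc n))  ≡⟨ ∑-allFin-suc {n} _ ⟩
    f zero + 0 + ∑ (λ i → 0 * f (suc i)) (allFin n)       ≡⟨ cong₂ _+_ (+-identityʳ (f zero)) (∑-*ˡ 0 (f ∘ suc) (allFin n)) ⟩
    f zero + 0                                             ≡⟨ +-identityʳ (f zero) ⟩
    f zero                                                 ∎
    where open ≡-Reasoning
  ∑-allFin-δ {suc n} (suc y) f = trans (∑-allFin-suc {n} (λ i → [ does (i ≟ suc y) ] * f i)) (∑-allFin-δ y (f ∘ suc))

  ∑-two-valued : ∀ {A : Set} (f : A → ℕ) u L xs → (∀ x → x ∈ xs → f x ≡ u * L ⊎ f x ≡ u * (L + 1)) →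
    ∃[ N ] N ≤ length xs × ∑ f xs ≡ u * (L * length xs + N)
  ∑-two-valued f u L []       _   = 0 , z≤n , solve 2 (λ u L → con 0 := u :* (L :* con 0 :+ con 0)) refl u L
  ∑-two-valued f u L (x ∷ xs) two with ∑-two-valued f u L xs (λ y → two y ∘ there) | two x (here refl)
  ... | N , N≤n , ∑≡ | inj₁ fx≡ = N , m≤n⇒m≤1+n N≤n , trans (cong₂ _+_ fx≡ ∑≡)
    (solve 4 (λ u L n N → u :* L :+ u :* (L :* n :+ N) := u :* (L :* (con 1 :+ n) :+ N)) refl u L (length xs) N)
  ... | N , N≤n , ∑≡ | inj₂ fx≡ = suc N , s≤s N≤n , trans (cong₂ _+_ fx≡ ∑≡)
    (solve 4 (λ u L n N → u :* (L :+ con 1) :+ u :* (L :* n :+ N) := u :* (L :* (con 1 :+ n) :+ (con 1 :+ N))) refl u L (length xs) N)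

module Arithmetic where

  open import Data.Nat.Base using (ℕ; zero; suc; pred; _+_; _*_; _^_; _∸_; _≤_; _<_; _>_; z≤n; s≤s; s≤s⁻¹; NonZero)
  open import Data.Nat.Coprimality using (Coprime; coprime-factors; 1-coprimeTo)
  open import Data.Nat.Divisibility using (_∣_; ∣-trans; m∣m*n; ∣m+n∣m⇒∣n; ∣1⇒≡1)
  open import Data.Nat.Properties
  open import Data.Nat.Solver using (module +-*-Solver)
  open import Data.Product.Base using (_×_; _,_; ∃-syntax)
  open import Relation.Binary.PropositionalEquality using (_≡_; refl; sym; trans; cong; subst; module ≡-Reasoning)

  open +-*-Solver using (solve; _:+_; _:*_; _:=_; con)

  θ : ℕ → ℕ → ℕ
  θ Q zero    = 0
  θ Q (suc n) = θ Q n + Q ^ n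

  θ-suc : ∀ Q n → θ Q (suc n) ≡ 1 + Q * θ Q n
  θ-suc Q zero    = cong suc (sym (*-zeroʳ Q))
  θ-suc Q (suc n) = trans (cong (_+ Q ^ suc n) (θ-suc Q n)) (cong suc (sym (*-distribˡ-+ Q (θ Q n) (Q ^ n))))

  θ>0 : ∀ Q n → θ Q (suc n) > 0
  θ>0 Q n = subst (_> 0) (sym (θ-suc Q n)) (s≤s z≤n)

  θ-geometric : ∀ P n → suc P ^ n ≡ 1 + P * θ (suc P) n
  θ-geometric P zero    = cong suc (sym (*-zeroʳ P))
  θ-geometric P (suc n) = begin
    suc P ^ n + P * suc P ^ n            ≡⟨ cong (_+ P * suc P ^ n) (θ-geometric P n) ⟩
    1 + P * θ (suc P) n + P * suc P ^ n  ≡⟨ cong suc (sym (*-distribˡ-+ P (θ (suc P) n) (suc P ^ n))) ⟩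
    1 + P * θ (suc P) (suc n)            ∎
    where open ≡-Reasoning

  θ-coprime : ∀ {q Q} → q ∣ Q → ∀ n → Coprime q (θ Q (suc n))
  θ-coprime {q} {Q} q∣Q n {d} (d∣q , d∣θ) =
    ∣1⇒≡1 (∣m+n∣m⇒∣n d∣Qθ+1 (∣-trans d∣q (∣-trans q∣Q (m∣m*n (θ Q n)))))
    where
    d∣Qθ+1 : d ∣ Q * θ Q n + 1
    d∣Qθ+1 = subst (d ∣_) (trans (θ-suc Q n) (+-comm 1 (Q * θ Q n))) d∣θ

  coprime-* : ∀ {a b n} → Coprime a n → Coprime b n → Coprime (a * b) n
  coprime-* {a} {b} a⊥n b⊥n (d∣ab , d∣n) = b⊥n (coprime-factors a⊥n (d∣ab , ∣-trans d∣n (m∣m*n b)) , d∣n)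

  coprime-^ : ∀ {a n} k → Coprime a n → Coprime (a ^ k) n
  coprime-^ {n = n} zero    _   = 1-coprimeTo n
  coprime-^         (suc k) a⊥n = coprime-* a⊥n (coprime-^ k a⊥n)

  excess-cancelʳ : ∀ {x y r k} θ → x * θ ≡ y * θ + r → 0 < r → r < suc k * θ →
    ∃[ t ] 1 ≤ t × t ≤ k × x ≡ y + t
  excess-cancelʳ {x} {y} {r} {k} θ xθ≡yθ+r r>0 r<[1+k]θ =
    x ∸ y , m<n⇒0<n∸m y<x , t≤k , sym (m+[n∸m]≡n (<⇒≤ y<x))
    where
    y<x : y < x
    y<x = *-cancelʳ-< θ y x (subst (y * θ <_) (sym xθ≡yθ+r) (m<m+n (y * θ) r>0))
    tθ≡r : (x ∸ y) * θ ≡ r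
    tθ≡r = +-cancelˡ-≡ (y * θ) _ _ (begin
      y * θ + (x ∸ y) * θ ≡⟨ sym (*-distribʳ-+ θ y (x ∸ y)) ⟩
      (y + (x ∸ y)) * θ   ≡⟨ cong (_* θ) (m+[n∸m]≡n (<⇒≤ y<x)) ⟩
      x * θ               ≡⟨ xθ≡yθ+r ⟩
      y * θ + r           ∎)
      where open ≡-Reasoning
    t≤k : x ∸ y ≤ k
    t≤k = s≤s⁻¹ (*-cancelʳ-< θ (x ∸ y) (suc k) (subst (_< suc k * θ) (sym tθ≡r) r<[1+k]θ))

  -- `suc p ^ 2` reduces to `suc` of a polynomial in p, which `pred` exposes to `θ-geometric` and the solver.
  q^[m*2] : ∀ p m → suc p ^ (m * 2) ≡ 1 + suc (suc p) * (p * θ (suc p ^ 2) m)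
  q^[m*2] p m = begin
    suc p ^ (m * 2)                          ≡⟨ cong (suc p ^_) (*-comm m 2) ⟩
    suc p ^ (2 * m)                          ≡⟨ sym (^-*-assoc (suc p) 2 m) ⟩
    (suc p ^ 2) ^ m                          ≡⟨ θ-geometric (pred (suc p ^ 2)) m ⟩
    1 + pred (suc p ^ 2) * θ (suc p ^ 2) m   ≡⟨ cong suc (solve 2 (λ p t → (p :* con 1 :+ p :* (con 1 :+ p :* con 1)) :* t
                                                                      := (con 2 :+ p) :* (p :* t)) refl p (θ (suc p ^ 2) m)) ⟩
    1 + suc (suc p) * (p * θ (suc p ^ 2) m)  ∎
    where open ≡-Reasoning

  x≡r+[1+c]*L⇒L+1≤x : ∀ {x r c L} → x ≡ r + suc c * L → 1 ≤ r → L + 1 ≤ x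
  x≡r+[1+c]*L⇒L+1≤x {x} {r} {c} {L} x≡ r≥1 = begin
    L + 1            ≡⟨ +-comm L 1 ⟩
    1 + L            ≤⟨ +-mono-≤ r≥1 (m≤m+n L (c * L)) ⟩
    r + suc c * L    ≡⟨ sym x≡ ⟩
    x                ∎
    where open ≤-Reasoning

  ^<θ : ∀ q .{{_ : NonZero q}} n → q ^ (2 + n) < θ (q ^ 2) (2 + n)
  ^<θ q n = begin-strict
    q ^ (2 + n)                          ≤⟨ ^-monoʳ-≤ q 2+n≤2*[1+n] ⟩
    q ^ (2 * suc n)                      ≡⟨ sym (^-*-assoc q 2 (suc n)) ⟩
    (q ^ 2) ^ suc n                      <⟨ m<n+m _ (θ>0 (q ^ 2) n) ⟩
    θ (q ^ 2) (suc n) + (q ^ 2) ^ suc n  ∎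
    where
    open ≤-Reasoning
    2+n≤2*[1+n] : 2 + n ≤ 2 * suc n
    2+n≤2*[1+n] = subst (2 + n ≤_) (sym (*-suc 2 n)) (+-monoʳ-≤ 2 (m≤m+n n (n + 0)))

module Geometry where

  open import Algebra.Bundles using (CommutativeRing)
  open import Data.Bool.Base using (Bool; true; false; _∧_)
  open import Data.Bool.Properties using (∧-identityʳ) renaming (_≟_ to _≟ᵇ_)
  open import Data.Empty using (⊥-elim)
  open import Data.Fin.Base using (Fin; zero; suc)
  open import Data.Fin.Properties using (_≟_; all?; ¬∀⟶∃¬)
  open import Data.List.Base using (List; map; concatMap; filter; length; allFin; foldr)
  open import Data.List.Membership.Propositional using (_∈_)
  open import Data.List.Membership.Propositional.Properties using (∈-filter⁻)
  open import Data.List.Properties using (map-tabulate)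
  open import Data.Nat.Base using (ℕ; zero; suc; _+_; _*_; _^_; _≤_; _<_; NonZero)
  open import Data.Nat.Coprimality using (Coprime; coprime-divisor)
  open import Data.Nat.Divisibility using (_∣_; divides)
  import Data.Nat.Properties as ℕ
  open import Data.Nat.Solver using (module +-*-Solver)
  open import Data.Product.Base using (_×_; _,_; proj₁; proj₂; ∃-syntax)
  open import Data.Sum.Base using (_⊎_; inj₁; inj₂)
  open import Function.Base using (_∘_)
  open import Function.Bundles using (_⇔_; mk⇔; Equivalence)
  open import Level using (0ℓ)
  open import Relation.Binary.PropositionalEquality using (_≡_; _≢_; refl; sym; trans; cong; cong₂; subst; module ≡-Reasoning)
  open import Relation.Nullary.Decidable using (does; yes; no; dec-true; dec-false; does-⇔)

  open import Defs
  open Sums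
  open Arithmetic using (θ; θ-suc; excess-cancelʳ)

  open +-*-Solver using (solve; _:+_; _:*_; _:=_; con)

  module Coordinates {Q : ℕ} (F : FiniteField Q) where

    open FiniteField F

    ring : CommutativeRing 0ℓ 0ℓ
    ring = record { isCommutativeRing = isCommutativeRing }

    open CommutativeRing ring using (+-group; zeroˡ; zeroʳ)
      renaming (+-identityˡ to ⊕-identityˡ; +-identityʳ to ⊕-identityʳ; *-assoc to ⊗-assoc; *-comm to ⊗-comm;
                *-identityˡ to ⊗-identityˡ; *-identityʳ to ⊗-identityʳ)
    open import Algebra.Properties.Group +-group using (y≈x\\z; \\-leftDividesˡ)

    ⊕-solveˡ : ∀ u d c → u ⊕ d ≡ c ⇔ d ≡ (⊖ u) ⊕ c
    ⊕-solveˡ u d c = mk⇔ (y≈x\\z u d c) (λ { refl → \\-leftDividesˡ u c })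

    ⊗-solveˡ : ∀ {a} (a≢0 : a ≢ 0#) i c → a ⊗ i ≡ c ⇔ i ≡ proj₁ (inverse a a≢0) ⊗ c
    ⊗-solveˡ {a} a≢0 i c = mk⇔ to from
      where
      open ≡-Reasoning
      b : Fin Q
      b = proj₁ (inverse a a≢0)
      ab≡1 : a ⊗ b ≡ 1#
      ab≡1 = proj₂ (inverse a a≢0)
      to : a ⊗ i ≡ c → i ≡ b ⊗ c
      to refl = begin
        i             ≡⟨ sym (⊗-identityˡ i) ⟩
        1# ⊗ i        ≡⟨ cong (_⊗ i) (trans (sym ab≡1) (⊗-comm a b)) ⟩
        (b ⊗ a) ⊗ i   ≡⟨ ⊗-assoc b a i ⟩
        b ⊗ (a ⊗ i)   ∎
      from : i ≡ b ⊗ c → a ⊗ i ≡ c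
      from refl = begin
        a ⊗ (b ⊗ c)   ≡⟨ sym (⊗-assoc a b c) ⟩
        (a ⊗ b) ⊗ c   ≡⟨ cong (_⊗ c) ab≡1 ⟩
        1# ⊗ c        ≡⟨ ⊗-identityˡ c ⟩
        c             ∎

    -- `allVectors` prepends a coordinate with a function local to Defs; unifying against the
    -- definition of `allVectors` recovers that function, whose clauses then compute as usual.
    private
      consOf : ∀ {n} {c : Fin Q → Vector F n → Vector F (suc n)} →
        allVectors F (suc n) ≡ concatMap (λ a → map (c a) (allVectors F n)) (allFin Q) →
        Fin Q → Vector F n → Vector F (suc n)
      consOf {c = c} _ = c

    prepend : ∀ {n} → Fin Q → Vector F n → Vector F (suc n)
    prepend = consOf refl

    dot-suc : ∀ {n} (a x : Vector F (suc n)) → dot F a x ≡ (a zero ⊗ x zero) ⊕ dot F (a ∘ suc) (x ∘ suc)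
    dot-suc a x = cong (λ xs → (a zero ⊗ x zero) ⊕ foldr _⊕_ 0# xs)
      (trans (map-tabulate suc (λ i → a i ⊗ x i)) (sym (map-tabulate (λ i → i) (λ i → a (suc i) ⊗ x (suc i)))))

    dot-zeroˡ : ∀ {n} (a : Vector F n) → (∀ i → a i ≡ 0#) → ∀ x → dot F a x ≡ 0#
    dot-zeroˡ {zero}  a a≡0 x = refl
    dot-zeroˡ {suc n} a a≡0 x = begin
      dot F a x                                      ≡⟨ dot-suc a x ⟩
      (a zero ⊗ x zero) ⊕ dot F (a ∘ suc) (x ∘ suc)  ≡⟨ cong₂ _⊕_ a₀x₀≡0 (dot-zeroˡ (a ∘ suc) (a≡0 ∘ suc) (x ∘ suc)) ⟩
      0# ⊕ 0#                                        ≡⟨ ⊕-identityʳ 0# ⟩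
      0#                                             ∎
      where
      open ≡-Reasoning
      a₀x₀≡0 : a zero ⊗ x zero ≡ 0#
      a₀x₀≡0 = trans (cong (_⊗ x zero) (a≡0 zero)) (zeroˡ (x zero))

    dot-prepend-0# : ∀ {n} (a : Vector F (suc n)) v → dot F a (prepend 0# v) ≡ dot F (a ∘ suc) v
    dot-prepend-0# a v = trans (dot-suc a (prepend 0# v))
      (trans (cong (_⊕ dot F (a ∘ suc) v) (zeroʳ (a zero))) (⊕-identityˡ (dot F (a ∘ suc) v)))

    dot-prepend-≟ : ∀ {n} (a : Vector F (suc n)) x₀ v c →
      does (dot F a (prepend x₀ v) ≟ c) ≡ does (dot F (a ∘ suc) v ≟ (⊖ (a zero ⊗ x₀)) ⊕ c)
    dot-prepend-≟ a x₀ v c = does-⇔ (mk⇔ (to ∘ trans (sym dot≡)) (trans dot≡ ∘ from)) (_ ≟ c) (_ ≟ _)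
      where
      dot≡ : dot F a (prepend x₀ v) ≡ (a zero ⊗ x₀) ⊕ dot F (a ∘ suc) v
      dot≡ = dot-suc a (prepend x₀ v)
      open Equivalence (⊕-solveˡ (a zero ⊗ x₀) (dot F (a ∘ suc) v) c)

    dot-leading : ∀ {n} (a : Vector F (suc n)) → (∀ i → a (suc i) ≡ 0#) → ∀ x₀ v →
      dot F a (prepend x₀ v) ≡ a zero ⊗ x₀
    dot-leading a tail≡0 x₀ v = trans (dot-suc a (prepend x₀ v))
      (trans (cong ((a zero ⊗ x₀) ⊕_) (dot-zeroˡ (a ∘ suc) tail≡0 v)) (⊕-identityʳ (a zero ⊗ x₀)))

    leading-or-tail : ∀ {n} (a : Vector F (suc n)) → ∃[ i ] a i ≢ 0# →
      (a zero ≢ 0# × (∀ i → a (suc i) ≡ 0#)) ⊎ (∃[ i ] a (suc i) ≢ 0#)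
    leading-or-tail a a≢0 with all? (λ j → a (suc j) ≟ 0#)
    ... | no tail≢0 = inj₂ (¬∀⟶∃¬ _ _ (λ j → a (suc j) ≟ 0#) tail≢0)
    leading-or-tail a (zero  , a₀≢0) | yes tail≡0 = inj₁ (a₀≢0 , tail≡0)
    leading-or-tail a (suc j , aⱼ≢0) | yes tail≡0 = ⊥-elim (aⱼ≢0 (tail≡0 j))

    normalised⇒nonzero : ∀ {n} (v : Vector F n) → isNormalised F v ≡ true → ∃[ i ] v i ≢ 0#
    normalised⇒nonzero {zero}  v ()
    normalised⇒nonzero {suc n} v v-normalised with v zero ≟ 0#
    ... | no v₀≢0 = zero , v₀≢0
    ... | yes _   with normalised⇒nonzero (v ∘ suc) v-normalised
    ...   | i , vᵢ≢0 = suc i , vᵢ≢0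

    count : ∀ n → (Vector F n → Bool) → ℕ
    count n P = ∑ (λ x → [ P x ]) (allVectors F n)

    count-cong : ∀ n {P R : Vector F n → Bool} → (∀ x → P x ≡ R x) → count n P ≡ count n R
    count-cong n P≡R = ∑-cong (λ x → cong [_] (P≡R x)) (allVectors F n)

    count-suc : ∀ n (P : Vector F (suc n) → Bool) → count (suc n) P ≡ ∑ (λ a → count n (P ∘ prepend a)) (allFin Q)
    count-suc n P = trans (∑-concatMap _ _ (allFin Q)) (∑-cong (λ a → ∑-map _ (prepend a) (allVectors F n)) (allFin Q))

    count-const : ∀ n b → count n (λ _ → b) ≡ [ b ] * Q ^ n
    count-const zero    b = trans (ℕ.+-identityʳ [ b ]) (sym (ℕ.*-identityʳ [ b ]))
    count-const (suc n) b = begin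
      count (suc n) (λ _ → b)                  ≡⟨ count-suc n (λ _ → b) ⟩
      ∑ (λ _ → count n (λ _ → b)) (allFin Q)   ≡⟨ ∑-cong (λ _ → count-const n b) (allFin Q) ⟩
      ∑ (λ _ → [ b ] * Q ^ n) (allFin Q)       ≡⟨ ∑-allFin-const Q ([ b ] * Q ^ n) ⟩
      Q * ([ b ] * Q ^ n)                      ≡⟨ solve 3 (λ x y z → x :* (y :* z) := y :* (x :* z)) refl Q [ b ] (Q ^ n) ⟩
      [ b ] * Q ^ suc n                        ∎
      where open ≡-Reasoning

    normalised-prepend : ∀ {n} i (v : Vector F n) b →
      [ isNormalised F (prepend i v) ∧ b ] ≡ [ does (i ≟ 0#) ] * [ isNormalised F v ∧ b ] + [ does (i ≟ 1#) ] * [ b ]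
    normalised-prepend i v b with i ≟ 0#
    ... | yes refl rewrite dec-false (0# ≟ 1#) 0≢1 = sym (trans (ℕ.+-identityʳ _) (ℕ.+-identityʳ _))
    ... | no _ = [∧] (does (i ≟ 1#)) b

    count-normalised-suc : ∀ n (P : Vector F (suc n) → Bool) →
      count (suc n) (λ x → isNormalised F x ∧ P x) ≡
      count n (λ v → isNormalised F v ∧ P (prepend 0# v)) + count n (P ∘ prepend 1#)
    count-normalised-suc n P = begin
      count (suc n) (λ x → isNormalised F x ∧ P x)                       ≡⟨ count-suc n _ ⟩
      ∑ (λ i → count n (λ v → isNormalised F (prepend i v) ∧ P (prepend i v))) (allFin Q)
                                                                         ≡⟨ ∑-cong split (allFin Q) ⟩
      ∑ (λ i → δ₀ i * A i + δ₁ i * B i) (allFin Q)                       ≡⟨ ∑-+ (λ i → δ₀ i * A i) (λ i → δ₁ i * B i) (allFin Q) ⟩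
      ∑ (λ i → δ₀ i * A i) (allFin Q) + ∑ (λ i → δ₁ i * B i) (allFin Q)  ≡⟨ cong₂ _+_ (∑-allFin-δ 0# A) (∑-allFin-δ 1# B) ⟩
      A 0# + B 1#                                                        ∎
      where
      open ≡-Reasoning
      δ₀ δ₁ A B : Fin Q → ℕ
      δ₀ i = [ does (i ≟ 0#) ]
      δ₁ i = [ does (i ≟ 1#) ]
      A i = count n (λ v → isNormalised F v ∧ P (prepend i v))
      B i = count n (P ∘ prepend i)
      split : ∀ i → count n (λ v → isNormalised F (prepend i v) ∧ P (prepend i v)) ≡ δ₀ i * A i + δ₁ i * B i
      split i = trans (∑-cong (λ v → normalised-prepend i v (P (prepend i v))) Fⁿ)
        (trans (∑-+ (λ v → δ₀ i * a v) (λ v → δ₁ i * b v) Fⁿ) (cong₂ _+_ (∑-*ˡ (δ₀ i) a Fⁿ) (∑-*ˡ (δ₁ i) b Fⁿ)))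
        where
        Fⁿ : List (Vector F n)
        Fⁿ = allVectors F n
        a b : Vector F n → ℕ
        a v = [ isNormalised F v ∧ P (prepend i v) ]
        b v = [ P (prepend i v) ]

    count-normalised : ∀ n → count n (isNormalised F) ≡ θ Q n
    count-normalised zero    = refl
    count-normalised (suc n) = begin
      count (suc n) (isNormalised F)                                  ≡⟨ count-cong (suc n) (λ x → sym (∧-identityʳ _)) ⟩
      count (suc n) (λ x → isNormalised F x ∧ true)                   ≡⟨ count-normalised-suc n (λ _ → true) ⟩
      count n (λ v → isNormalised F v ∧ true) + count n (λ _ → true)  ≡⟨ cong₂ _+_ normalised all ⟩
      θ Q n + Q ^ n                                                   ∎
      where
      open ≡-Reasoning
      normalised : count n (λ v → isNormalised F v ∧ true) ≡ θ Q n
      normalised = trans (count-cong n (λ v → ∧-identityʳ _)) (count-normalised n)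
      all : count n (λ _ → true) ≡ Q ^ n
      all = trans (count-const n true) (ℕ.*-identityˡ (Q ^ n))

    count-affine : ∀ n (a : Vector F (suc n)) → ∃[ i ] a i ≢ 0# → ∀ c →
      count (suc n) (λ x → does (dot F a x ≟ c)) ≡ Q ^ n
    count-affine n a a≢0 c with leading-or-tail a a≢0
    ... | inj₁ (a₀≢0 , tail≡0) = begin
      count (suc n) (λ x → does (dot F a x ≟ c))                               ≡⟨ count-suc n _ ⟩
      ∑ (λ x₀ → count n (λ v → does (dot F a (prepend x₀ v) ≟ c))) (allFin Q)  ≡⟨ ∑-cong count-x₀ (allFin Q) ⟩
      ∑ (λ x₀ → [ does (x₀ ≟ y) ] * Q ^ n) (allFin Q)                          ≡⟨ ∑-allFin-δ y (λ _ → Q ^ n) ⟩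
      Q ^ n                                                                    ∎
      where
      open ≡-Reasoning
      y : Fin Q
      y = proj₁ (inverse (a zero) a₀≢0) ⊗ c
      count-x₀ : ∀ x₀ → count n (λ v → does (dot F a (prepend x₀ v) ≟ c)) ≡ [ does (x₀ ≟ y) ] * Q ^ n
      count-x₀ x₀ = trans (count-cong n (λ v → trans (cong (λ z → does (z ≟ c)) (dot-leading a tail≡0 x₀ v))
                                                     (does-⇔ (⊗-solveˡ a₀≢0 x₀ c) (a zero ⊗ x₀ ≟ c) (x₀ ≟ y))))
                          (count-const n (does (x₀ ≟ y)))
    count-affine zero    a _ c | inj₂ (() , _)
    count-affine (suc n) a _ c | inj₂ tail≢0 = begin
      count (suc (suc n)) (λ x → does (dot F a x ≟ c))                               ≡⟨ count-suc (suc n) _ ⟩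
      ∑ (λ x₀ → count (suc n) (λ v → does (dot F a (prepend x₀ v) ≟ c))) (allFin Q)  ≡⟨ ∑-cong count-x₀ (allFin Q) ⟩
      ∑ (λ _ → Q ^ n) (allFin Q)                                                     ≡⟨ ∑-allFin-const Q (Q ^ n) ⟩
      Q ^ suc n                                                                      ∎
      where
      open ≡-Reasoning
      count-x₀ : ∀ x₀ → count (suc n) (λ v → does (dot F a (prepend x₀ v) ≟ c)) ≡ Q ^ n
      count-x₀ x₀ = trans (count-cong (suc n) (λ v → dot-prepend-≟ a x₀ v c)) (count-affine n (a ∘ suc) tail≢0 _)

    count-hyperplane : ∀ n (a : Vector F (suc n)) → ∃[ i ] a i ≢ 0# →
      count (suc n) (λ x → isNormalised F x ∧ does (dot F a x ≟ 0#)) ≡ θ Q n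
    count-hyperplane n a a≢0 with leading-or-tail a a≢0
    ... | inj₁ (a₀≢0 , tail≡0) = begin
      count (suc n) (λ x → isNormalised F x ∧ does (dot F a x ≟ 0#))  ≡⟨ count-normalised-suc n _ ⟩
      count n (λ v → isNormalised F v ∧ does (dot F a (prepend 0# v) ≟ 0#)) + count n (λ v → does (dot F a (prepend 1# v) ≟ 0#))
                                                                      ≡⟨ cong₂ _+_ (trans (count-cong n on-0) (count-normalised n))
                                                                                   (trans (count-cong n off-1) (count-const n false)) ⟩
      θ Q n + 0                                                       ≡⟨ ℕ.+-identityʳ (θ Q n) ⟩
      θ Q n                                                           ∎
      where
      open ≡-Reasoning
      on-0 : ∀ v → isNormalised F v ∧ does (dot F a (prepend 0# v) ≟ 0#) ≡ isNormalised F v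
      on-0 v = trans (cong (isNormalised F v ∧_) (dec-true (_ ≟ 0#) (trans (dot-leading a tail≡0 0# v) (zeroʳ (a zero)))))
                     (∧-identityʳ _)
      off-1 : ∀ v → does (dot F a (prepend 1# v) ≟ 0#) ≡ false
      off-1 v = dec-false (_ ≟ 0#) λ a·x≡0 →
        a₀≢0 (trans (sym (⊗-identityʳ (a zero))) (trans (sym (dot-leading a tail≡0 1# v)) a·x≡0))
    count-hyperplane zero    a _ | inj₂ (() , _)
    count-hyperplane (suc n) a _ | inj₂ tail≢0 = begin
      count (suc (suc n)) (λ x → isNormalised F x ∧ does (dot F a x ≟ 0#))  ≡⟨ count-normalised-suc (suc n) _ ⟩
      count (suc n) (λ v → isNormalised F v ∧ does (dot F a (prepend 0# v) ≟ 0#))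
        + count (suc n) (λ v → does (dot F a (prepend 1# v) ≟ 0#))          ≡⟨ cong₂ _+_ on-tail-hyperplane on-tail-affine ⟩
      θ Q n + Q ^ n                                                         ∎
      where
      open ≡-Reasoning
      on-tail-hyperplane : count (suc n) (λ v → isNormalised F v ∧ does (dot F a (prepend 0# v) ≟ 0#)) ≡ θ Q n
      on-tail-hyperplane = trans (count-cong (suc n) (λ v → cong (λ z → isNormalised F v ∧ does (z ≟ 0#)) (dot-prepend-0# a v)))
                                 (count-hyperplane n (a ∘ suc) tail≢0)
      on-tail-affine : count (suc n) (λ v → does (dot F a (prepend 1# v) ≟ 0#)) ≡ Q ^ n
      on-tail-affine = trans (count-cong (suc n) (λ v → dot-prepend-≟ a 1# v 0#)) (count-affine n (a ∘ suc) tail≢0 _)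

  module ProjectiveSpace {Q : ℕ} (F : FiniteField Q) where

    open Coordinates F

    number-of-points : ∀ s → length (projPoints F s) ≡ θ Q (suc s)
    number-of-points s = trans (length-filter (allVectors F (suc s))) (count-normalised (suc s))

    points-on-hyperplane : ∀ s a → isNormalised F a ≡ true → ∑ (λ x → [ incident F a x ]) (projPoints F s) ≡ θ Q s
    points-on-hyperplane s a a-normalised = begin
      ∑ (λ x → [ incident F a x ]) (projPoints F s)                  ≡⟨ ∑-filter (isNormalised F) _ Fˢ⁺¹ ⟩
      ∑ (λ x → [ isNormalised F x ] * [ incident F a x ]) Fˢ⁺¹       ≡⟨ ∑-cong (λ x → sym ([∧] (isNormalised F x) _)) Fˢ⁺¹ ⟩
      count (suc s) (λ x → isNormalised F x ∧ incident F a x)        ≡⟨ count-hyperplane s a (normalised⇒nonzero a a-normalised) ⟩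
      θ Q s                                                          ∎
      where
      open ≡-Reasoning
      Fˢ⁺¹ : List (Vector F (suc s))
      Fˢ⁺¹ = allVectors F (suc s)

    module _ {s} (Ω : HyperplaneFamily F s) where

      -- `degree` filters with a conjunction local to Defs; unification recovers its filtering predicate.
      private
        predicateOf : ∀ {A : Set} (xs : List A) {P : A → Bool} n → n ≡ length (filter (λ a → P a ≟ᵇ true) xs) → A → Bool
        predicateOf _ {P} _ _ = P

      through : Vector F (suc s) → Vector F (suc s) → Bool
      through x = predicateOf (projPoints F s) (degree F Ω x) refl

      through-∧ : ∀ x a → through x a ≡ Ω a ∧ incident F a x
      through-∧ x a with Ω a
      ... | true  = refl
      ... | false = refl

      degree≡∑ : ∀ x → degree F Ω x ≡ ∑ (λ a → [ Ω a ] * [ incident F a x ]) (projPoints F s)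
      degree≡∑ x = trans (length-filter (projPoints F s))
        (∑-cong (λ a → trans (cong [_] (through-∧ x a)) ([∧] (Ω a) (incident F a x))) (projPoints F s))

      ∑-degree : ∑ (degree F Ω) (projPoints F s) ≡ size F Ω * θ Q s
      ∑-degree = begin
        ∑ (degree F Ω) P                                       ≡⟨ ∑-cong degree≡∑ P ⟩
        ∑ (λ x → ∑ (λ a → [ Ω a ] * [ incident F a x ]) P) P   ≡⟨ ∑-comm (λ x a → [ Ω a ] * [ incident F a x ]) P P ⟩
        ∑ (λ a → ∑ (λ x → [ Ω a ] * [ incident F a x ]) P) P   ≡⟨ ∑-cong-∈ P hyperplane ⟩
        ∑ (λ a → [ Ω a ] * θ Q s) P                            ≡⟨ ∑-*ʳ (θ Q s) (λ a → [ Ω a ]) P ⟩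
        ∑ (λ a → [ Ω a ]) P * θ Q s                            ≡⟨ cong (_* θ Q s) (sym (length-filter P)) ⟩
        size F Ω * θ Q s                                       ∎
        where
        open ≡-Reasoning
        P : List (Vector F (suc s))
        P = projPoints F s
        hyperplane : ∀ {a} → a ∈ P → ∑ (λ x → [ Ω a ] * [ incident F a x ]) P ≡ [ Ω a ] * θ Q s
        hyperplane {a} a∈P = trans (∑-*ˡ [ Ω a ] (λ x → [ incident F a x ]) P)
          (cong ([ Ω a ] *_) (points-on-hyperplane s a (proj₂ (∈-filter⁻ (λ v → isNormalised F v ≟ᵇ true) {xs = allVectors F (suc s)} a∈P))))

  size-of-two-degree-family : ∀ {Q} (F : FiniteField Q) s (Ω : HyperplaneFamily F s) u .{{_ : NonZero u}} L →
    Coprime u (θ Q s) → 1 ≤ L → L + 1 < θ Q s →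
    (∀ x → x ∈ projPoints F s → degree F Ω x ≡ u * L ⊎ degree F Ω x ≡ u * (L + 1)) →
    ∃[ Ω₁ ] size F Ω ≡ Ω₁ * u × ∃[ t ] 1 ≤ t × t ≤ Q × Ω₁ ≡ Q * L + t
  size-of-two-degree-family {Q} F s Ω u L u⊥θ L≥1 L+1<θ degrees
    with ∑-two-valued (degree F Ω) u L (projPoints F s) degrees
  ... | N , N≤#points , ∑≡ = Ω₁ , size≡Ω₁u , excess-cancelʳ θₛ Ω₁θ≡ (ℕ.≤-trans L≥1 (ℕ.m≤m+n L N)) L+N<[1+Q]θ
    where
    open ProjectiveSpace F
    θₛ : ℕ
    θₛ = θ Q s
    #points≡ : length (projPoints F s) ≡ 1 + Q * θₛ
    #points≡ = trans (number-of-points s) (θ-suc Q s)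
    double-count : size F Ω * θₛ ≡ u * (L * (1 + Q * θₛ) + N)
    double-count = trans (sym (∑-degree Ω)) (trans ∑≡ (cong (λ n → u * (L * n + N)) #points≡))
    u∣size : u ∣ size F Ω
    u∣size = coprime-divisor u⊥θ (divides (L * (1 + Q * θₛ) + N)
      (trans (ℕ.*-comm θₛ (size F Ω)) (trans double-count (ℕ.*-comm u (L * (1 + Q * θₛ) + N)))))
    Ω₁ : ℕ
    Ω₁ = _∣_.quotient u∣size
    size≡Ω₁u : size F Ω ≡ Ω₁ * u
    size≡Ω₁u = _∣_.equality u∣size
    Ω₁θ≡ : Ω₁ * θₛ ≡ Q * L * θₛ + (L + N)
    Ω₁θ≡ = trans (ℕ.*-cancelˡ-≡ _ _ u (begin
        u * (Ω₁ * θₛ)               ≡⟨ solve 3 (λ u a t → u :* (a :* t) := a :* u :* t) refl u Ω₁ θₛ ⟩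
        Ω₁ * u * θₛ                 ≡⟨ cong (_* θₛ) (sym size≡Ω₁u) ⟩
        size F Ω * θₛ               ≡⟨ double-count ⟩
        u * (L * (1 + Q * θₛ) + N)  ∎))
      (solve 4 (λ L Q t N → L :* (con 1 :+ Q :* t) :+ N := Q :* L :* t :+ (L :+ N)) refl L Q θₛ N)
      where open ≡-Reasoning
    L+N<[1+Q]θ : L + N < suc Q * θₛ
    L+N<[1+Q]θ = begin-strict
      L + N               ≤⟨ ℕ.+-monoʳ-≤ L (subst (N ≤_) #points≡ N≤#points) ⟩
      L + (1 + Q * θₛ)    ≡⟨ sym (ℕ.+-assoc L 1 (Q * θₛ)) ⟩
      L + 1 + Q * θₛ      <⟨ ℕ.+-monoˡ-< (Q * θₛ) L+1<θ ⟩
      θₛ + Q * θₛ         ∎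
      where open ℕ.≤-Reasoning

open import Defs
open import Data.Nat using (ℕ; suc; _<_; _≤_; _∸_; _%_) renaming (_+_ to _+ⁿ_; _*_ to _*ⁿ_; _^_ to _^ⁿ_)
open import Data.Integer using (ℤ; +_; _+_; _-_; _*_; _^_; -1ℤ; 1ℤ)
open import Data.Integer.DivMod using (_/_)
open import Data.Product using (_×_; ∃-syntax)
open import Data.Sum using (_⊎_)
open import Data.List.Membership.Propositional using (_∈_)
open import Relation.Binary.PropositionalEquality using (_≡_)

open Arithmetic using (θ; θ-suc; θ>0; θ-coprime; coprime-^; q^[m*2]; x≡r+[1+c]*L⇒L+1≤x; ^<θ)
open Geometry using (size-of-two-degree-family)
open import Data.Integer.DivMod using (div-pos-is-/ℕ)
import Data.Integer.Properties as ℤ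
open import Data.Nat.Base using (zero; NonZero; z≤n; s≤s; s≤s⁻¹)
open import Data.Nat.Coprimality using (Coprime)
open import Data.Nat.Divisibility using (m∣m*n)
open import Data.Nat.DivMod using (m*n/n≡m; m*n%n≡0; [m+kn]%n≡m%n) renaming (_/_ to _/ⁿ_)
import Data.Nat.Properties as ℕ
open import Data.Nat.Solver using (module +-*-Solver)
open import Data.Product.Base using (_,_)
open import Data.Sum.Base using (swap) renaming (map to map-⊎)
open import Relation.Binary.PropositionalEquality using (refl; sym; trans; cong; cong₂; module ≡-Reasoning)
open import Relation.Nullary.Negation using (contradiction)

open +-*-Solver using (solve; _:+_; _:*_; _:=_; con)

pos-^ : ∀ a n → + (a ^ⁿ n) ≡ (+ a) ^ n
pos-^ a zero    = refl
pos-^ a (suc n) = trans (ℤ.pos-* a (a ^ⁿ n)) (cong (+ a *_) (pos-^ a n))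

-1^[n*2] : ∀ n → -1ℤ ^ (n *ⁿ 2) ≡ 1ℤ
-1^[n*2] zero    = refl
-1^[n*2] (suc n) = trans (sym (ℤ.*-assoc -1ℤ -1ℤ _)) (trans (ℤ.*-identityˡ _) (-1^[n*2] n))

pos-+-minus : ∀ a b → + (a +ⁿ b) - + a ≡ + b
pos-+-minus a b = trans (ℤ.m-n≡m⊖n (a +ⁿ b) a) (trans (ℤ.⊖-≥ (ℕ.m≤m+n a b)) (cong +_ (ℕ.m+n∸m≡n a b)))

exact-/ : ∀ {z} d k → z ≡ + (suc d *ⁿ k) → z / + suc d ≡ + k
exact-/ d k refl = trans (div-pos-is-/ℕ (+ (suc d *ⁿ k)) (suc d))
  (cong +_ (trans (cong (_/ⁿ suc d) (ℕ.*-comm (suc d) k)) (m*n/n≡m k (suc d))))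

pos-^*[^+1] : ∀ q a b → + (q ^ⁿ a *ⁿ (q ^ⁿ b +ⁿ 1)) ≡ (+ q) ^ a * ((+ q) ^ b + 1ℤ)
pos-^*[^+1] q a b = trans (ℤ.pos-* (q ^ⁿ a) (q ^ⁿ b +ⁿ 1)) (cong₂ _*_ (pos-^ q a) (cong (_+ 1ℤ) (pos-^ q b)))

pos-^*[^-1] : ∀ q a b {X} → q ^ⁿ b ≡ 1 +ⁿ X → + (q ^ⁿ a *ⁿ X) ≡ (+ q) ^ a * ((+ q) ^ b - 1ℤ)
pos-^*[^-1] q a b {X} q^b≡1+X = trans (ℤ.pos-* (q ^ⁿ a) X) (cong₂ _*_ (pos-^ q a) (sym q^b-1≡X))
  where
  q^b-1≡X : (+ q) ^ b - 1ℤ ≡ + X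
  q^b-1≡X = trans (cong (_- 1ℤ) (trans (sym (pos-^ q b)) (cong +_ q^b≡1+X))) (pos-+-minus 1 X)

TwoDegrees : (q s : ℕ) (F : FiniteField (q ^ⁿ 2)) → HyperplaneFamily F s → Set
TwoDegrees q s F Ω = ∀ x → x ∈ projPoints F s →
  (+ degree F Ω x ≡ ((+ q) ^ s * ((+ q) ^ (s ∸ 1) - -1ℤ ^ (s ∸ 1))) / (+ suc q))
  ⊎ (+ degree F Ω x ≡ ((+ q) ^ (s ∸ 1) * ((+ q) ^ s - -1ℤ ^ s)) / (+ suc q))

SizeFormula : (q s : ℕ) (F : FiniteField (q ^ⁿ 2)) → HyperplaneFamily F s → Set
SizeFormula q s F Ω = ∃[ Ω₁ ] (size F Ω ≡ Ω₁ *ⁿ q ^ⁿ (s ∸ 1)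
  × ∃[ t ] (1 ≤ t × t ≤ q ^ⁿ 2
    × (s % 2 ≡ 0 → + Ω₁ ≡ (((+ q) ^ (s +ⁿ 2) - 1ℤ) / (+ suc q)) - ((+ q) - 1ℤ) + + t)
    × (s % 2 ≡ 1 → + Ω₁ ≡ (((+ q) ^ (s +ⁿ 2) + 1ℤ) / (+ suc q)) - ((+ q) * (+ q) - (+ q) + 1ℤ) + + t)))

-- s = 2(j + 1): the degrees are u·(L + 1) and u·L with u = q^(s-1) and L = (q^s - 1)/(q + 1).
module EvenDimension (p j : ℕ) where

  q s u L : ℕ
  q = suc p
  s = suc j *ⁿ 2
  u = q ^ⁿ suc (j *ⁿ 2)
  L = p *ⁿ θ (q ^ⁿ 2) (suc j)

  q^s≡ : q ^ⁿ s ≡ 1 +ⁿ suc q *ⁿ L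
  q^s≡ = q^[m*2] p (suc j)

  degree₁ : ((+ q) ^ s * ((+ q) ^ (s ∸ 1) - -1ℤ ^ (s ∸ 1))) / (+ suc q) ≡ + (u *ⁿ (L +ⁿ 1))
  degree₁ = exact-/ q (u *ⁿ (L +ⁿ 1)) (begin
    (+ q) ^ s * ((+ q) ^ (s ∸ 1) - -1ℤ ^ (s ∸ 1))
      ≡⟨ cong (λ z → (+ q) ^ s * ((+ q) ^ (s ∸ 1) - -1ℤ * z)) (-1^[n*2] j) ⟩
    (+ q) ^ s * ((+ q) ^ (s ∸ 1) + 1ℤ)
      ≡⟨ sym (pos-^*[^+1] q s (s ∸ 1)) ⟩
    + (q ^ⁿ s *ⁿ (u +ⁿ 1))
      ≡⟨ cong +_ (solve 2 (λ q u → q :* u :* (u :+ con 1) := u :* (q :* u :+ q)) refl q u) ⟩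
    + (u *ⁿ (q ^ⁿ s +ⁿ q))
      ≡⟨ cong (λ z → + (u *ⁿ (z +ⁿ q))) q^s≡ ⟩
    + (u *ⁿ (1 +ⁿ suc q *ⁿ L +ⁿ q))
      ≡⟨ cong +_ (solve 3 (λ q u L → u :* (con 1 :+ (con 1 :+ q) :* L :+ q) := (con 1 :+ q) :* (u :* (L :+ con 1))) refl q u L) ⟩
    + (suc q *ⁿ (u *ⁿ (L +ⁿ 1)))
      ∎)
    where open ≡-Reasoning

  degree₂ : ((+ q) ^ (s ∸ 1) * ((+ q) ^ s - -1ℤ ^ s)) / (+ suc q) ≡ + (u *ⁿ L)
  degree₂ = exact-/ q (u *ⁿ L) (begin
    (+ q) ^ (s ∸ 1) * ((+ q) ^ s - -1ℤ ^ s)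
      ≡⟨ cong (λ z → (+ q) ^ (s ∸ 1) * ((+ q) ^ s - z)) (-1^[n*2] (suc j)) ⟩
    (+ q) ^ (s ∸ 1) * ((+ q) ^ s - 1ℤ)
      ≡⟨ sym (pos-^*[^-1] q (s ∸ 1) s q^s≡) ⟩
    + (u *ⁿ (suc q *ⁿ L))
      ≡⟨ cong +_ (solve 3 (λ q u L → u :* ((con 1 :+ q) :* L) := (con 1 :+ q) :* (u :* L)) refl q u L) ⟩
    + (suc q *ⁿ (u *ⁿ L))
      ∎)
    where open ≡-Reasoning

  size-formula : ∀ t → (((+ q) ^ (s +ⁿ 2) - 1ℤ) / (+ suc q)) - ((+ q) - 1ℤ) + + t ≡ + (q ^ⁿ 2 *ⁿ L +ⁿ t)
  size-formula t = begin
    (((+ q) ^ (s +ⁿ 2) - 1ℤ) / (+ suc q)) - ((+ q) - 1ℤ) + + t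
      ≡⟨ cong₂ (λ a b → a - b + + t) (exact-/ q _ numerator) (pos-+-minus 1 p) ⟩
    + (p +ⁿ Q *ⁿ L) - + p + + t
      ≡⟨ cong (_+ + t) (pos-+-minus p (Q *ⁿ L)) ⟩
    + (Q *ⁿ L +ⁿ t)
      ∎
    where
    open ≡-Reasoning
    Q : ℕ
    Q = q ^ⁿ 2
    q^[s+2]≡ : q ^ⁿ (s +ⁿ 2) ≡ 1 +ⁿ suc q *ⁿ (p +ⁿ Q *ⁿ L)
    q^[s+2]≡ = begin
      q ^ⁿ (s +ⁿ 2)                                 ≡⟨ cong (λ e → q ^ⁿ (2 +ⁿ e)) (ℕ.+-comm (j *ⁿ 2) 2) ⟩
      q ^ⁿ (suc (suc j) *ⁿ 2)                       ≡⟨ q^[m*2] p (suc (suc j)) ⟩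
      1 +ⁿ suc q *ⁿ (p *ⁿ θ Q (suc (suc j)))        ≡⟨ cong (λ z → 1 +ⁿ suc q *ⁿ (p *ⁿ z)) (θ-suc Q (suc j)) ⟩
      1 +ⁿ suc q *ⁿ (p *ⁿ (1 +ⁿ Q *ⁿ θ Q (suc j)))
        ≡⟨ cong (λ z → 1 +ⁿ suc q *ⁿ z) (solve 3 (λ p Q t → p :* (con 1 :+ Q :* t) := p :+ Q :* (p :* t)) refl p Q (θ Q (suc j))) ⟩
      1 +ⁿ suc q *ⁿ (p +ⁿ Q *ⁿ L)                   ∎
    numerator : (+ q) ^ (s +ⁿ 2) - 1ℤ ≡ + (suc q *ⁿ (p +ⁿ Q *ⁿ L))
    numerator = trans (cong (_- 1ℤ) (trans (sym (pos-^ q (s +ⁿ 2))) (cong +_ q^[s+2]≡))) (pos-+-minus 1 _)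

-- s = 2j + 3: the degrees are u·L and u·(L + 1) with u = q^(s-1) and L = q(q^(s-1) - 1)/(q + 1).
module OddDimension (p j : ℕ) where

  q s u L : ℕ
  q = suc p
  s = suc (suc j *ⁿ 2)
  u = q ^ⁿ (suc j *ⁿ 2)
  L = q *ⁿ (p *ⁿ θ (q ^ⁿ 2) (suc j))

  u≡ : u ≡ 1 +ⁿ suc q *ⁿ (p *ⁿ θ (q ^ⁿ 2) (suc j))
  u≡ = q^[m*2] p (suc j)

  q^s≡ : q ^ⁿ s ≡ q +ⁿ suc q *ⁿ L
  q^s≡ = trans (cong (q *ⁿ_) u≡)
    (solve 3 (λ q p t → q :* (con 1 :+ (con 1 :+ q) :* (p :* t)) := q :+ (con 1 :+ q) :* (q :* (p :* t))) refl q p (θ (q ^ⁿ 2) (suc j)))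

  degree₁ : ((+ q) ^ s * ((+ q) ^ (s ∸ 1) - -1ℤ ^ (s ∸ 1))) / (+ suc q) ≡ + (u *ⁿ L)
  degree₁ = exact-/ q (u *ⁿ L) (begin
    (+ q) ^ s * ((+ q) ^ (s ∸ 1) - -1ℤ ^ (s ∸ 1))
      ≡⟨ cong (λ z → (+ q) ^ s * ((+ q) ^ (s ∸ 1) - z)) (-1^[n*2] (suc j)) ⟩
    (+ q) ^ s * ((+ q) ^ (s ∸ 1) - 1ℤ)
      ≡⟨ sym (pos-^*[^-1] q s (s ∸ 1) u≡) ⟩
    + (q ^ⁿ s *ⁿ (suc q *ⁿ (p *ⁿ θ (q ^ⁿ 2) (suc j))))
      ≡⟨ cong +_ (solve 4 (λ q u p t → q :* u :* ((con 1 :+ q) :* (p :* t)) := (con 1 :+ q) :* (u :* (q :* (p :* t))))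
                          refl q u p (θ (q ^ⁿ 2) (suc j))) ⟩
    + (suc q *ⁿ (u *ⁿ L))
      ∎)
    where open ≡-Reasoning

  degree₂ : ((+ q) ^ (s ∸ 1) * ((+ q) ^ s - -1ℤ ^ s)) / (+ suc q) ≡ + (u *ⁿ (L +ⁿ 1))
  degree₂ = exact-/ q (u *ⁿ (L +ⁿ 1)) (begin
    (+ q) ^ (s ∸ 1) * ((+ q) ^ s - -1ℤ ^ s)
      ≡⟨ cong (λ z → (+ q) ^ (s ∸ 1) * ((+ q) ^ s - -1ℤ * z)) (-1^[n*2] (suc j)) ⟩
    (+ q) ^ (s ∸ 1) * ((+ q) ^ s + 1ℤ)
      ≡⟨ sym (pos-^*[^+1] q (s ∸ 1) s) ⟩
    + (u *ⁿ (q ^ⁿ s +ⁿ 1))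
      ≡⟨ cong (λ z → + (u *ⁿ (z +ⁿ 1))) q^s≡ ⟩
    + (u *ⁿ (q +ⁿ suc q *ⁿ L +ⁿ 1))
      ≡⟨ cong +_ (solve 3 (λ q u L → u :* (q :+ (con 1 :+ q) :* L :+ con 1) := (con 1 :+ q) :* (u :* (L :+ con 1))) refl q u L) ⟩
    + (suc q *ⁿ (u *ⁿ (L +ⁿ 1)))
      ∎)
    where open ≡-Reasoning

  size-formula : ∀ t → (((+ q) ^ (s +ⁿ 2) + 1ℤ) / (+ suc q)) - ((+ q) * (+ q) - (+ q) + 1ℤ) + + t ≡ + (q ^ⁿ 2 *ⁿ L +ⁿ t)
  size-formula t = begin
    (((+ q) ^ (s +ⁿ 2) + 1ℤ) / (+ suc q)) - ((+ q) * (+ q) - (+ q) + 1ℤ) + + t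
      ≡⟨ cong₂ (λ a b → a - b + + t) (exact-/ q _ numerator) q²-q+1≡ ⟩
    + (q *ⁿ p +ⁿ 1 +ⁿ Q *ⁿ L) - + (q *ⁿ p +ⁿ 1) + + t
      ≡⟨ cong (_+ + t) (pos-+-minus (q *ⁿ p +ⁿ 1) (Q *ⁿ L)) ⟩
    + (Q *ⁿ L +ⁿ t)
      ∎
    where
    open ≡-Reasoning
    Q : ℕ
    Q = q ^ⁿ 2
    q^[s+2]+1≡ : q ^ⁿ (s +ⁿ 2) +ⁿ 1 ≡ suc q *ⁿ (q *ⁿ p +ⁿ 1 +ⁿ Q *ⁿ L)
    q^[s+2]+1≡ = begin
      q ^ⁿ (s +ⁿ 2) +ⁿ 1                                  ≡⟨ cong (λ e → q ^ⁿ (3 +ⁿ e) +ⁿ 1) (ℕ.+-comm (j *ⁿ 2) 2) ⟩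
      q *ⁿ q ^ⁿ (suc (suc j) *ⁿ 2) +ⁿ 1                   ≡⟨ cong (λ z → q *ⁿ z +ⁿ 1) (q^[m*2] p (suc (suc j))) ⟩
      q *ⁿ (1 +ⁿ suc q *ⁿ (p *ⁿ θ Q (suc (suc j)))) +ⁿ 1  ≡⟨ cong (λ z → q *ⁿ (1 +ⁿ suc q *ⁿ (p *ⁿ z)) +ⁿ 1) (θ-suc Q (suc j)) ⟩
      q *ⁿ (1 +ⁿ suc q *ⁿ (p *ⁿ (1 +ⁿ Q *ⁿ θ Q (suc j)))) +ⁿ 1
        ≡⟨ solve 4 (λ q p Q t → q :* (con 1 :+ (con 1 :+ q) :* (p :* (con 1 :+ Q :* t))) :+ con 1
                                := (con 1 :+ q) :* (q :* p :+ con 1 :+ Q :* (q :* (p :* t)))) refl q p Q (θ Q (suc j)) ⟩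
      suc q *ⁿ (q *ⁿ p +ⁿ 1 +ⁿ Q *ⁿ L)                    ∎
    numerator : (+ q) ^ (s +ⁿ 2) + 1ℤ ≡ + (suc q *ⁿ (q *ⁿ p +ⁿ 1 +ⁿ Q *ⁿ L))
    numerator = trans (cong (_+ 1ℤ) (sym (pos-^ q (s +ⁿ 2)))) (cong +_ q^[s+2]+1≡)
    q²-q+1≡ : (+ q) * (+ q) - (+ q) + 1ℤ ≡ + (q *ⁿ p +ⁿ 1)
    q²-q+1≡ = cong (_+ 1ℤ) (begin
      (+ q) * (+ q) - + q     ≡⟨ cong (_- + q) (sym (ℤ.pos-* q q)) ⟩
      + (q *ⁿ q) - + q        ≡⟨ cong (λ z → + z - + q) (solve 1 (λ p → (con 1 :+ p) :* (con 1 :+ p) := (con 1 :+ p) :+ (con 1 :+ p) :* p) refl p) ⟩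
      + (q +ⁿ q *ⁿ p) - + q   ≡⟨ pos-+-minus q (q *ⁿ p) ⟩
      + (q *ⁿ p)              ∎)

data Parity : ℕ → Set where
  even : ∀ j → Parity (suc j *ⁿ 2)
  odd  : ∀ j → Parity (suc (suc j *ⁿ 2))

parity : ∀ n → Parity (2 +ⁿ n)
parity zero          = even 0
parity (suc zero)    = odd 0
parity (suc (suc n)) with parity n
... | even j = even (suc j)
... | odd  j = odd (suc j)

even-dimension : ∀ p j → 1 ≤ p → (F : FiniteField (suc p ^ⁿ 2)) (Ω : HyperplaneFamily F (suc j *ⁿ 2)) →
  TwoDegrees (suc p) (suc j *ⁿ 2) F Ω → SizeFormula (suc p) (suc j *ⁿ 2) F Ω
even-dimension p j 1≤p F Ω degrees = conclude (size-of-two-degree-family F s Ω u L u⊥θ L≥1 L+1<θ degrees′)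
  where
  open EvenDimension p j
  instance
    u≢0 : NonZero u
    u≢0 = ℕ.m^n≢0 q (s ∸ 1)
  u⊥θ : Coprime u (θ (q ^ⁿ 2) s)
  u⊥θ = coprime-^ (s ∸ 1) (θ-coprime (m∣m*n (q ^ⁿ 1)) (s ∸ 1))
  L≥1 : 1 ≤ L
  L≥1 = ℕ.*-mono-≤ 1≤p (θ>0 (q ^ⁿ 2) j)
  L+1<θ : L +ⁿ 1 < θ (q ^ⁿ 2) s
  L+1<θ = ℕ.≤-<-trans (x≡r+[1+c]*L⇒L+1≤x {r = 1} {c = q} q^s≡ ℕ.≤-refl) (^<θ q (j *ⁿ 2))
  degrees′ : ∀ x → x ∈ projPoints F s → degree F Ω x ≡ u *ⁿ L ⊎ degree F Ω x ≡ u *ⁿ (L +ⁿ 1)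
  degrees′ x x∈ = map-⊎ (λ e → ℤ.+-injective (trans e degree₂)) (λ e → ℤ.+-injective (trans e degree₁)) (swap (degrees x x∈))
  conclude : (∃[ Ω₁ ] size F Ω ≡ Ω₁ *ⁿ u × ∃[ t ] 1 ≤ t × t ≤ q ^ⁿ 2 × Ω₁ ≡ q ^ⁿ 2 *ⁿ L +ⁿ t) → SizeFormula q s F Ω
  conclude (Ω₁ , size≡ , t , t≥1 , t≤Q , Ω₁≡) = Ω₁ , size≡ , t , t≥1 , t≤Q ,
    (λ _ → trans (cong +_ Ω₁≡) (sym (size-formula t))) ,
    (λ s%2≡1 → contradiction (trans (sym (m*n%n≡0 (suc j) 2)) s%2≡1) λ ())

odd-dimension : ∀ p j → 1 ≤ p → (F : FiniteField (suc p ^ⁿ 2)) (Ω : HyperplaneFamily F (suc (suc j *ⁿ 2))) →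
  TwoDegrees (suc p) (suc (suc j *ⁿ 2)) F Ω → SizeFormula (suc p) (suc (suc j *ⁿ 2)) F Ω
odd-dimension p j 1≤p F Ω degrees = conclude (size-of-two-degree-family F s Ω u L u⊥θ L≥1 L+1<θ degrees′)
  where
  open OddDimension p j
  instance
    u≢0 : NonZero u
    u≢0 = ℕ.m^n≢0 q (s ∸ 1)
  u⊥θ : Coprime u (θ (q ^ⁿ 2) s)
  u⊥θ = coprime-^ (s ∸ 1) (θ-coprime (m∣m*n (q ^ⁿ 1)) (s ∸ 1))
  L≥1 : 1 ≤ L
  L≥1 = ℕ.*-mono-≤ {1} {q} {1} {p *ⁿ θ (q ^ⁿ 2) (suc j)} (s≤s z≤n) (ℕ.*-mono-≤ 1≤p (θ>0 (q ^ⁿ 2) j))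
  L+1<θ : L +ⁿ 1 < θ (q ^ⁿ 2) s
  L+1<θ = ℕ.≤-<-trans (x≡r+[1+c]*L⇒L+1≤x {r = q} {c = q} q^s≡ (s≤s z≤n)) (^<θ q (suc (j *ⁿ 2)))
  degrees′ : ∀ x → x ∈ projPoints F s → degree F Ω x ≡ u *ⁿ L ⊎ degree F Ω x ≡ u *ⁿ (L +ⁿ 1)
  degrees′ x x∈ = map-⊎ (λ e → ℤ.+-injective (trans e degree₁)) (λ e → ℤ.+-injective (trans e degree₂)) (degrees x x∈)
  conclude : (∃[ Ω₁ ] size F Ω ≡ Ω₁ *ⁿ u × ∃[ t ] 1 ≤ t × t ≤ q ^ⁿ 2 × Ω₁ ≡ q ^ⁿ 2 *ⁿ L +ⁿ t) → SizeFormula q s F Ω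
  conclude (Ω₁ , size≡ , t , t≥1 , t≤Q , Ω₁≡) = Ω₁ , size≡ , t , t≥1 , t≤Q ,
    (λ s%2≡0 → contradiction (trans (sym ([m+kn]%n≡m%n 1 (suc j) 2)) s%2≡0) λ ()) ,
    (λ _ → trans (cong +_ Ω₁≡) (sym (size-formula t)))

mainTheorem4 : (q s : ℕ) → IsPrimePower q → 2 < q → 3 ≤ s →
    (F : FiniteField (q ^ⁿ 2)) → (Ω : HyperplaneFamily F s) →
    0 < size F Ω →
    (∀ x → x ∈ projPoints F s →
      (+ degree F Ω x ≡ ((+ q) ^ s * ((+ q) ^ (s ∸ 1) - -1ℤ ^ (s ∸ 1))) / (+ suc q))
      ⊎ (+ degree F Ω x ≡ ((+ q) ^ (s ∸ 1) * ((+ q) ^ s - -1ℤ ^ s)) / (+ suc q))) →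
    ∃[ Ω₁ ] (size F Ω ≡ Ω₁ *ⁿ q ^ⁿ (s ∸ 1)
      × ∃[ t ] (1 ≤ t × t ≤ q ^ⁿ 2
        × (s % 2 ≡ 0 → + Ω₁ ≡ (((+ q) ^ (s +ⁿ 2) - 1ℤ) / (+ suc q)) - ((+ q) - 1ℤ) + + t)
        × (s % 2 ≡ 1 → + Ω₁ ≡ (((+ q) ^ (s +ⁿ 2) + 1ℤ) / (+ suc q)) - ((+ q) * (+ q) - (+ q) + 1ℤ) + + t)))
mainTheorem4 zero    _ _ ()
mainTheorem4 (suc p) _ _ q>2 (s≤s (s≤s {n = n} _)) F Ω _ degrees with parity n
... | even j = even-dimension p j (ℕ.<⇒≤ (s≤s⁻¹ q>2)) F Ω degrees
... | odd  j = odd-dimension  p j (ℕ.<⇒≤ (s≤s⁻¹ q>2)) F Ω degrees
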